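{- Let $\mathbf{C}$ be the natural deduction system described in the context. $\mathbf{C}$ is consistent; in particular, no atomic formula has a proof (a deduction with no undischarged assumptions) in $\mathbf{C}$.
   Context: Formulas are built from atomic formulas (formulas containing no connective) by the connectives $\neg$ (unary), $\supset$, $\land$, $\lor$. Deductions in $\mathbf{C}$ are trees of formula occurrences whose leaves are assumptions; each assumption belongs to an assumption class marked by a number, and a rule discharging class $i$ (written $[X]^i$) discharges all assumptions of that class above the indicated premise. A single assumption $A$ is a deduction of $A$ from $A$. Rules ($C$ arbitrary): $\land I$: from $A$, $B$, and a deduction of $C$ from $[A\land B]$, infer $C$. $\land E$: from $A\land B$ and a deduction of $C$ from $[A]$, $[B]$, infer $C$. $\lor I$: from $A$ (or from $B$) and a deduction of $C$ from $[A\lor B]$, infer $C$. $\lor E$: from $A\lor B$, a deduction of $C$ from $[A]$, and a deduction of $C$ from $[B]$, infer $C$. $\supset I$: from $B$ and a deduction of $C$ from $[A\supset B]$, infer $C$. $TR$ (Tarski's Rule): from a deduction of $C$ from $[A]$ and a deduction of $C$ from $[A\supset B]$, infer $C$. $\supset E$: from $A\supset B$, $A$, and a deduction of $C$ from $[B]$, infer $C$. $\neg I$: from a deduction of $C$ from $[A]$ and a deduction of $C$ from $[\neg A]$, infer $C$. $\neg E$: from $\neg A$ and $A$, infer $C$. -}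

module Defs where

open import Data.Nat using (ℕ)
open import Data.List using (List; []; _∷_)
open import Data.List.Membership.Propositional using (_∈_)
open import Relation.Nullary using (¬_)
open import Data.Product using (_×_)

infixr 8 _∧_
infixr 7 _∨_
infixr 6 _⊃_
infix 9 ~_

data Formula : Set where
  atom : ℕ → Formula
  ~_   : Formula → Formula
  _⊃_  : Formula → Formula → Formula
  _∧_  : Formula → Formula → Formula
  _∨_  : Formula → Formula → Formula

-- Γ ⊢ C : there is a deduction in C of C whose undischarged assumptions
-- are among Γ.  A discharged assumption class [X] in a subdeduction is
-- modelled by extending the context of that subdeduction with X
-- (vacuous discharge allowed, as usual).
infix 2 _⊢_
data _⊢_ (Γ : List Formula) : Formula → Set where
  ass  : ∀ {A} → A ∈ Γ → Γ ⊢ A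
  ∧I   : ∀ {A B C} → Γ ⊢ A → Γ ⊢ B → (A ∧ B ∷ Γ) ⊢ C → Γ ⊢ C
  ∧E   : ∀ {A B C} → Γ ⊢ A ∧ B → (A ∷ B ∷ Γ) ⊢ C → Γ ⊢ C
  ∨I₁  : ∀ {A B C} → Γ ⊢ A → (A ∨ B ∷ Γ) ⊢ C → Γ ⊢ C
  ∨I₂  : ∀ {A B C} → Γ ⊢ B → (A ∨ B ∷ Γ) ⊢ C → Γ ⊢ C
  ∨E   : ∀ {A B C} → Γ ⊢ A ∨ B → (A ∷ Γ) ⊢ C → (B ∷ Γ) ⊢ C → Γ ⊢ C
  ⊃I   : ∀ {A B C} → Γ ⊢ B → (A ⊃ B ∷ Γ) ⊢ C → Γ ⊢ C
  TR   : ∀ {A B C} → (A ∷ Γ) ⊢ C → (A ⊃ B ∷ Γ) ⊢ C → Γ ⊢ C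
  ⊃E   : ∀ {A B C} → Γ ⊢ A ⊃ B → Γ ⊢ A → (B ∷ Γ) ⊢ C → Γ ⊢ C
  ¬I   : ∀ {A C} → (A ∷ Γ) ⊢ C → (~ A ∷ Γ) ⊢ C → Γ ⊢ C
  ¬E   : ∀ {A C} → Γ ⊢ ~ A → Γ ⊢ A → Γ ⊢ C

Provable : Formula → Set
Provable A = [] ⊢ A

Consistent : Set
Consistent = ¬ (∀ A → Provable A)

-- Every rule of C is sound for the classical two-valued truth tables: the
-- ordinary rules because the connectives are read truth-functionally, and
-- Tarski's rule and ¬I because every formula is either true or false, so one
-- of the two discharged assumptions A, A ⊃ B (resp. A, ¬A) is true.  Hence a
-- proof only has true conclusions, and under the valuation making every atom
-- false no atom is provable.
module Submission where

open import Defs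
open import Data.Nat using (ℕ)
open import Data.Bool as Bool using (Bool; true; false; not; T)
open import Data.Bool.Properties using (T-∧; T-∨)
open import Data.Empty using (⊥-elim)
open import Data.List.Relation.Unary.All using (All; []; _∷_; lookup)
open import Data.Product using (_×_; _,_)
open import Data.Sum using (inj₁; inj₂)
open import Function using (_∘_)
open import Function.Bundles using (Equivalence)
open import Relation.Nullary using (¬_; yes; no)
open import Relation.Nullary.Decidable using (T?)

open Equivalence using (to; from)

T-not⁺ : ∀ {x} → ¬ T x → T (not x)
T-not⁺ {false} _ = _
T-not⁺ {true} ¬t = ¬t _

T-not⁻ : ∀ {x} → T (not x) → ¬ T x
T-not⁻ {false} _ ()

T-implies⁺ : ∀ {x y} → (T x → T y) → T (not x Bool.∨ y)
T-implies⁺ {false} _ = _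
T-implies⁺ {true} x⇒y = x⇒y _

T-implies⁻ : ∀ {x y} → T (not x Bool.∨ y) → T x → T y
T-implies⁻ {true} y _ = y

Valuation : Set
Valuation = ℕ → Bool

⟦_⟧ : Formula → Valuation → Bool
⟦ atom n ⟧ v = v n
⟦ ~ A ⟧ v = not (⟦ A ⟧ v)
⟦ A ⊃ B ⟧ v = not (⟦ A ⟧ v) Bool.∨ ⟦ B ⟧ v
⟦ A ∧ B ⟧ v = ⟦ A ⟧ v Bool.∧ ⟦ B ⟧ v
⟦ A ∨ B ⟧ v = ⟦ A ⟧ v Bool.∨ ⟦ B ⟧ v

infix 2 _⊨_
_⊨_ : Valuation → Formula → Set
v ⊨ A = T (⟦ A ⟧ v)

sound : ∀ {v Γ C} → Γ ⊢ C → All (v ⊨_) Γ → v ⊨ C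
sound (ass A∈Γ) ρ = lookup ρ A∈Γ
sound (∧I d e f) ρ = sound f (from T-∧ (sound d ρ , sound e ρ) ∷ ρ)
sound (∧E d f) ρ with to T-∧ (sound d ρ)
... | a , b = sound f (a ∷ b ∷ ρ)
sound (∨I₁ d f) ρ = sound f (from T-∨ (inj₁ (sound d ρ)) ∷ ρ)
sound (∨I₂ d f) ρ = sound f (from T-∨ (inj₂ (sound d ρ)) ∷ ρ)
sound (∨E d f g) ρ with to T-∨ (sound d ρ)
... | inj₁ a = sound f (a ∷ ρ)
... | inj₂ b = sound g (b ∷ ρ)
sound (⊃I d f) ρ = sound f (T-implies⁺ (λ _ → sound d ρ) ∷ ρ)
sound {v} (TR {A} f g) ρ with T? (⟦ A ⟧ v)
... | yes a = sound f (a ∷ ρ)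
... | no ¬a = sound g (T-implies⁺ (⊥-elim ∘ ¬a) ∷ ρ)
sound (⊃E d e f) ρ = sound f (T-implies⁻ (sound d ρ) (sound e ρ) ∷ ρ)
sound {v} (¬I {A} f g) ρ with T? (⟦ A ⟧ v)
... | yes a = sound f (a ∷ ρ)
... | no ¬a = sound g (T-not⁺ ¬a ∷ ρ)
sound (¬E d e) ρ = ⊥-elim (T-not⁻ (sound d ρ) (sound e ρ))

atom-unprovable : ∀ n → ¬ Provable (atom n)
atom-unprovable n ⊢atom = sound {v = λ _ → false} ⊢atom []

corollary5 : Consistent × (∀ (n : ℕ) → ¬ Provable (atom n))
corollary5 = (λ ⊢every → atom-unprovable 0 (⊢every (atom 0))) , atom-unprovable
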